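{- Let $p$ be an odd prime and $r$ a positive integer. Then $$\sum_{k=0}^{(p^r+1)/2}\frac{(4k-1)^3}{256^k(2k-1)^4}{2k\choose k}^4\equiv 3p^{4r} \pmod{p^{4r+1}},$$ $$\sum_{k=0}^{p^r-1}\frac{(4k-1)^3}{256^k(2k-1)^4}{2k\choose k}^4\equiv 3p^{4r} \pmod{p^{4r+1}}.$$
   Context: Congruences between rational numbers modulo a power of $p$ are understood in the ring of $p$-integral rationals. -}

module Defs where

open import Data.Nat as ℕ using (ℕ; zero; suc; NonZero)
open import Data.Nat.Properties using (m^n≢0; m*n≢0)
open import Data.Nat.Combinatorics using (_C_)
open import Data.Integer as ℤ using (ℤ; +_)
open import Data.Integer.Divisibility using () renaming (_∣_ to _∣ℤ_)
open import Data.Rational as ℚ using (ℚ; _/_)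
open import Data.Product using (Σ; _×_)
open import Relation.Nullary using (¬_)
open import Relation.Binary.PropositionalEquality using (_≡_)

-- |2k-1| as a natural number: 1 for k = 0, 2k-1 otherwise
absOdd : ℕ → ℕ
absOdd zero    = 1
absOdd (suc k) = suc (2 ℕ.* k)

absOdd-nz : ∀ k → NonZero (absOdd k)
absOdd-nz zero    = _
absOdd-nz (suc k) = _

denom : ℕ → ℕ
denom k = (256 ℕ.^ k) ℕ.* (absOdd k ℕ.^ 4)

denom-nz : ∀ k → NonZero (denom k)
denom-nz k = m*n≢0 (256 ℕ.^ k) (absOdd k ℕ.^ 4)
  {{m^n≢0 256 k}} {{m^n≢0 (absOdd k) 4 {{absOdd-nz k}}}}

-- (2k-1)^4 = |2k-1|^4, so the summand is
--   (4k-1)^3 * C(2k,k)^4 / (256^k (2k-1)^4)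
term : ℕ → ℚ
term k = (((((+ 4) ℤ.* (+ k) ℤ.- (+ 1)) ℤ.^ 3) ℤ.* (+ (((2 ℕ.* k) C k) ℕ.^ 4))) / denom k) {{denom-nz k}}

sumBelow : ℕ → (ℕ → ℚ) → ℚ
sumBelow zero    f = ℚ.0ℚ
sumBelow (suc n) f = sumBelow n f ℚ.+ f n

-- x ≡ y (mod p^m) in the ring of p-integral rationals:
-- x - y = a / b with a, b integers, p ∤ b and p^m ∣ a.
CongMod : ℚ → ℚ → ℕ → ℕ → Set
CongMod x y p m = Σ ℤ λ a → Σ ℤ λ b →
  (¬ (+ p ∣ℤ b)) × ((+ (p ℕ.^ m)) ∣ℤ a) × ((x ℚ.- y) ℚ.* (b ℚ./ 1) ≡ a ℚ./ 1)

-- The sum telescopes: with P(x) = 8x² − 12x + 3,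
--   Σ_{k<n} (4k−1)³ C(2k,k)⁴ / (256ᵏ (2k−1)⁴) = 16 n⁴ P(n) C(2n,n)⁴ / (256ⁿ (2n−1)⁴),
-- which, after clearing denominators, follows from (n+1) C(2n+2,n+1) = 2(2n+1) C(2n,n)
-- and P(n+1) (2n−1)⁴ = 16 n⁴ P(n) + (4n−1)³.
-- Let q = p^r. As p divides C(q,j) for 0 < j < q, Pascal's rule gives, modulo p,
-- C(2q,q) ≡ 2, 2^q ≡ 2 and C(q−1,j) ≡ ±1.
-- At n = q the closed form is q⁴ = p^{4r} times 16 P(q) C(2q,q)⁴ / (256^q (2q−1)⁴) ≡ 16·3·16/256 = 3.
-- At n = (q+3)/2 two steps of the central binomial recurrence extract q⁴ from C(2n,n)⁴, and the
-- remaining factor is again ≡ 3 because C(q−1,(q−1)/2)⁴ ≡ 1 and 2^q ≡ 2.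

module Submission where

open import Data.Nat.Base using (ℕ)
open import Data.Nat.Primality using (Prime)
open import Data.Integer.Base using (ℤ)
open import Relation.Binary.PropositionalEquality using (_≢_)

module Binomial where
  open import Data.Nat using (ℕ; zero; suc; _+_; _*_; _^_; _∸_)
  open import Data.Nat.Properties
  open import Data.Nat.Combinatorics
  open import Data.Nat.Tactic.RingSolver using (solve-∀)
  open import Relation.Binary.PropositionalEquality
  open ≡-Reasoning

  [1+k]*[1+n]C[1+k]≡[1+n]*nCk : ∀ n k → suc k * (suc n C suc k) ≡ suc n * (n C k)
  [1+k]*[1+n]C[1+k]≡[1+n]*nCk zero    zero    = refl
  [1+k]*[1+n]C[1+k]≡[1+n]*nCk zero    (suc k) = *-zeroʳ (suc (suc k))
  [1+k]*[1+n]C[1+k]≡[1+n]*nCk (suc n) zero    =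
    trans (+-identityʳ _) (trans (nC1≡n (suc (suc n))) (sym (*-identityʳ _)))
  [1+k]*[1+n]C[1+k]≡[1+n]*nCk (suc n) (suc k) = begin
    suc (suc k) * (suc (suc n) C suc (suc k))      ≡⟨ cong (suc (suc k) *_) (sym (nCk+nC[k+1]≡[n+1]C[k+1] (suc n) (suc k))) ⟩
    suc (suc k) * (a + b)                          ≡⟨ split k a b ⟩
    (a + suc k * a) + suc (suc k) * b              ≡⟨ cong₂ (λ u v → a + u + v) ([1+k]*[1+n]C[1+k]≡[1+n]*nCk n k)
                                                                                ([1+k]*[1+n]C[1+k]≡[1+n]*nCk n (suc k)) ⟩
    (a + suc n * (n C k)) + suc n * (n C suc k)    ≡⟨ merge a (suc n) (n C k) (n C suc k) ⟩
    a + suc n * (n C k + n C suc k)                ≡⟨ cong (λ u → a + suc n * u) (nCk+nC[k+1]≡[n+1]C[k+1] n k) ⟩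
    suc (suc n) * a                                ∎
    where
    a = suc n C suc k
    b = suc n C suc (suc k)
    split : ∀ k a b → suc (suc k) * (a + b) ≡ (a + suc k * a) + suc (suc k) * b
    split = solve-∀
    merge : ∀ a m x y → (a + m * x) + m * y ≡ a + m * (x + y)
    merge = solve-∀

  centralBinomial : ℕ → ℕ
  centralBinomial n = (2 * n) C n

  centralBinomial-recurrence : ∀ n → suc n * centralBinomial (suc n) ≡ 2 * suc (2 * n) * centralBinomial n
  centralBinomial-recurrence n = begin
    suc n * (2 * suc n C suc n)            ≡⟨ cong (λ m → suc n * (m C suc n)) (*-suc 2 n) ⟩
    suc n * (suc (suc (2 * n)) C suc n)    ≡⟨ cong (suc n *_) (sym (nCk+nC[k+1]≡[n+1]C[k+1] (suc (2 * n)) n)) ⟩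
    suc n * (suc (2 * n) C n + a)          ≡⟨ cong (λ u → suc n * (u + a)) symmetry ⟩
    suc n * (a + a)                        ≡⟨ double (suc n) a ⟩
    2 * (suc n * a)                        ≡⟨ cong (2 *_) ([1+k]*[1+n]C[1+k]≡[1+n]*nCk (2 * n) n) ⟩
    2 * (suc (2 * n) * centralBinomial n)  ≡⟨ sym (*-assoc 2 (suc (2 * n)) _) ⟩
    2 * suc (2 * n) * centralBinomial n    ∎
    where
    a = suc (2 * n) C suc n
    double : ∀ x y → x * (y + y) ≡ 2 * (x * y)
    double = solve-∀
    [1+2n]∸n≡1+n : suc (2 * n) ∸ n ≡ suc n
    [1+2n]∸n≡1+n = trans (cong (_∸ n) (1+2n≡n+[1+n] n)) (m+n∸m≡n n (suc n))
      where
      1+2n≡n+[1+n] : ∀ n → suc (2 * n) ≡ n + suc n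
      1+2n≡n+[1+n] = solve-∀
    symmetry : suc (2 * n) C n ≡ a
    symmetry = trans (nCk≡nC[n∸k] (≤-trans (m≤n*m n 2) (n≤1+n _))) (cong (suc (2 * n) C_) [1+2n]∸n≡1+n)

  partialRowSum : ℕ → ℕ → ℕ
  partialRowSum n zero    = 0
  partialRowSum n (suc k) = partialRowSum n k + n C k

  partialRowSum-pascal : ∀ n k → partialRowSum (suc n) (suc k) ≡ partialRowSum n (suc k) + partialRowSum n k
  partialRowSum-pascal n zero    = refl
  partialRowSum-pascal n (suc k) = begin
    partialRowSum (suc n) (suc k) + suc n C suc k
      ≡⟨ cong₂ _+_ (partialRowSum-pascal n k) (sym (nCk+nC[k+1]≡[n+1]C[k+1] n k)) ⟩
    (partialRowSum n (suc k) + partialRowSum n k) + (n C k + n C suc k)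
      ≡⟨ shuffle (partialRowSum n (suc k)) (partialRowSum n k) (n C k) (n C suc k) ⟩
    (partialRowSum n (suc k) + n C suc k) + (partialRowSum n k + n C k) ∎
    where
    shuffle : ∀ w x y z → (w + x) + (y + z) ≡ (w + z) + (x + y)
    shuffle = solve-∀

  rowSum≡2^n : ∀ n → partialRowSum n (suc n) ≡ 2 ^ n
  rowSum≡2^n zero    = refl
  rowSum≡2^n (suc n) = begin
    partialRowSum (suc n) (suc (suc n))          ≡⟨ partialRowSum-pascal n (suc n) ⟩
    partialRowSum n (suc (suc n)) + partialRowSum n (suc n)
                                                 ≡⟨ cong (λ u → partialRowSum n (suc n) + u + partialRowSum n (suc n)) (k>n⇒nCk≡0 (n<1+n n)) ⟩
    partialRowSum n (suc n) + 0 + partialRowSum n (suc n)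
                                                 ≡⟨ cong₂ (λ u v → u + 0 + v) (rowSum≡2^n n) (rowSum≡2^n n) ⟩
    2 ^ n + 0 + 2 ^ n                            ≡⟨ cong (_+ 2 ^ n) (+-identityʳ (2 ^ n)) ⟩
    2 ^ n + 2 ^ n                                ≡⟨ cong (2 ^ n +_) (sym (+-identityʳ (2 ^ n))) ⟩
    2 ^ suc n                                    ∎

module Congruence (m : ℤ) where
  open import Data.Nat using (zero; suc)
  open import Data.Integer using (+_; _+_; _*_; _-_; -_; _^_)
  open import Data.Integer.Properties using (*-zeroˡ; +-identityʳ; +-inverseʳ)
  open import Data.Integer.Divisibility.Signed
  open import Data.Integer.Tactic.RingSolver using (solve-∀)
  open import Relation.Binary.Bundles using (Setoid)
  open import Relation.Binary.PropositionalEquality using (_≡_; refl; sym; subst)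

  infix 4 _≈_
  record _≈_ (x y : ℤ) : Set where
    constructor ≈-by
    field
      ∣-difference : m ∣ x - y

  ∣⇒≈0 : ∀ {x} → m ∣ x → x ≈ + 0
  ∣⇒≈0 {x} m∣x = ≈-by (subst (m ∣_) (sym (+-identityʳ x)) m∣x)

  ≈0⇒∣ : ∀ {x} → x ≈ + 0 → m ∣ x
  ≈0⇒∣ {x} (≈-by m∣x-0) = subst (m ∣_) (+-identityʳ x) m∣x-0

  ≈-reflexive : ∀ {x y} → x ≡ y → x ≈ y
  ≈-reflexive {x} refl = ≈-by (subst (m ∣_) (sym (+-inverseʳ x)) (divides (+ 0) (sym (*-zeroˡ m))))

  ≈-refl : ∀ {x} → x ≈ x
  ≈-refl = ≈-reflexive refl

  ≈-sym : ∀ {x y} → x ≈ y → y ≈ x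
  ≈-sym {x} {y} (≈-by m∣x-y) = ≈-by (subst (m ∣_) (negate x y) (∣m⇒∣-m m∣x-y))
    where
    negate : ∀ x y → - (x - y) ≡ y - x
    negate = solve-∀

  ≈-trans : ∀ {x y z} → x ≈ y → y ≈ z → x ≈ z
  ≈-trans {x} {y} {z} (≈-by m∣x-y) (≈-by m∣y-z) = ≈-by (subst (m ∣_) (telescope x y z) (∣m∣n⇒∣m+n m∣x-y m∣y-z))
    where
    telescope : ∀ x y z → (x - y) + (y - z) ≡ x - z
    telescope = solve-∀

  ≈-setoid : Setoid _ _
  ≈-setoid = record
    { Carrier       = ℤ
    ; _≈_           = _≈_
    ; isEquivalence = record { refl = ≈-refl ; sym = ≈-sym ; trans = ≈-trans }
    }

  +-cong : ∀ {x y u v} → x ≈ y → u ≈ v → x + u ≈ y + v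
  +-cong {x} {y} {u} {v} (≈-by m∣x-y) (≈-by m∣u-v) = ≈-by (subst (m ∣_) (regroup x y u v) (∣m∣n⇒∣m+n m∣x-y m∣u-v))
    where
    regroup : ∀ x y u v → (x - y) + (u - v) ≡ (x + u) - (y + v)
    regroup = solve-∀

  -‿cong : ∀ {x y} → x ≈ y → - x ≈ - y
  -‿cong {x} {y} (≈-by m∣x-y) = ≈-by (subst (m ∣_) (negate x y) (∣m⇒∣-m m∣x-y))
    where
    negate : ∀ x y → - (x - y) ≡ - x - - y
    negate = solve-∀

  *-cong : ∀ {x y u v} → x ≈ y → u ≈ v → x * u ≈ y * v
  *-cong {x} {y} {u} {v} (≈-by m∣x-y) (≈-by m∣u-v) =
    ≈-by (subst (m ∣_) (regroup x y u v) (∣m∣n⇒∣m+n (∣m⇒∣m*n u m∣x-y) (∣n⇒∣m*n y m∣u-v)))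
    where
    regroup : ∀ x y u v → (x - y) * u + y * (u - v) ≡ x * u - y * v
    regroup = solve-∀

  -‿cong₂ : ∀ {x y u v} → x ≈ y → u ≈ v → x - u ≈ y - v
  -‿cong₂ x≈y u≈v = +-cong x≈y (-‿cong u≈v)

  ^-cong : ∀ {x y} → x ≈ y → ∀ n → x ^ n ≈ y ^ n
  ^-cong x≈y zero    = ≈-refl
  ^-cong x≈y (suc n) = *-cong x≈y (^-cong x≈y n)

module ModuloPrime (p : ℕ) (p-prime : Prime p) where
  open import Data.Nat as ℕ using (ℕ; zero; suc; _+_; _*_; _^_; _≤_; _<_)
  open import Data.Nat.Properties
  open import Data.Nat.Divisibility
  open import Data.Nat.Primality using (euclidsLemma; prime⇒nonZero; ¬prime[1])
  open import Data.Nat.Combinatorics using (_C_; nCn≡1; nCk≡nC[n∸k]; nCk+nC[k+1]≡[n+1]C[k+1])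
  open import Data.Nat.Tactic.RingSolver using (solve-∀)
  open import Data.Integer as ℤ using (+_)
  import Data.Integer.Properties as ℤ
  import Data.Integer.Tactic.RingSolver as ℤ-Solver
  open import Data.Integer.Divisibility.Signed using (∣ᵤ⇒∣)
  open import Data.Sum using (inj₁; inj₂)
  open import Data.Empty using (⊥-elim)
  open import Relation.Nullary using (¬_; yes; no)
  open import Relation.Binary.PropositionalEquality
  open Binomial
  open Congruence (+ p) public

  instance
    p≢0 : ℕ.NonZero p
    p≢0 = prime⇒nonZero p-prime

  p∤1 : ¬ p ∣ 1
  p∤1 p∣1 = ¬prime[1] (subst Prime (∣1⇒≡1 p∣1) p-prime)

  p∤m*n : ∀ {m n} → ¬ p ∣ m → ¬ p ∣ n → ¬ p ∣ m * n
  p∤m*n {m} {n} p∤m p∤n p∣m*n with euclidsLemma m n p-prime p∣m*n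
  ... | inj₁ p∣m = p∤m p∣m
  ... | inj₂ p∣n = p∤n p∣n

  p∤m^k : ∀ {m} → ¬ p ∣ m → ∀ k → ¬ p ∣ m ^ k
  p∤m^k p∤m zero    = p∤1
  p∤m^k p∤m (suc k) = p∤m*n p∤m (p∤m^k p∤m k)

  p^k∣m*n∧p∤n⇒p^k∣m : ∀ k {m n} → p ^ k ∣ m * n → ¬ p ∣ n → p ^ k ∣ m
  p^k∣m*n∧p∤n⇒p^k∣m zero    {m} _ _ = 1∣ m
  p^k∣m*n∧p∤n⇒p^k∣m (suc k) {m} {n} p^[1+k]∣m*n p∤n with euclidsLemma m n p-prime (∣-trans (m∣m*n (p ^ k)) p^[1+k]∣m*n)
  ... | inj₂ p∣n                  = ⊥-elim (p∤n p∣n)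
  ... | inj₁ (divides m′ refl) = subst (p ^ suc k ∣_) (*-comm p m′)
          (*-monoʳ-∣ p (p^k∣m*n∧p∤n⇒p^k∣m k (*-cancelˡ-∣ p (subst (p ^ suc k ∣_) (reassoc m′ p n) p^[1+k]∣m*n)) p∤n))
    where
    reassoc : ∀ a b c → a * b * c ≡ b * (a * c)
    reassoc = solve-∀

  ∣⇒+≈0 : ∀ {n} → p ∣ n → + n ≈ + 0
  ∣⇒+≈0 p∣n = ∣⇒≈0 (∣ᵤ⇒∣ p∣n)

  module PrimePower (q-1 r : ℕ) (q≡p^r : suc q-1 ≡ p ^ r) where

    q : ℕ
    q = suc q-1

    p∣qC[1+j] : ∀ {j} → suc j < q → p ∣ q C suc j
    p∣qC[1+j] {j} 1+j<q with p ∣? (q C suc j)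
    ... | yes p∣qC[1+j] = p∣qC[1+j]
    ... | no  p∤qC[1+j] = ⊥-elim (<⇒≱ 1+j<q (subst (_≤ suc j) (sym q≡p^r) (∣⇒≤ p^r∣1+j)))
      where
      p^r∣[1+j]*qC[1+j] : p ^ r ∣ suc j * (q C suc j)
      p^r∣[1+j]*qC[1+j] = subst (_∣ suc j * (q C suc j)) q≡p^r
        (divides (q-1 C j) (trans ([1+k]*[1+n]C[1+k]≡[1+n]*nCk q-1 j) (*-comm q (q-1 C j))))
      p^r∣1+j : p ^ r ∣ suc j
      p^r∣1+j = p^k∣m*n∧p∤n⇒p^k∣m r p^r∣[1+j]*qC[1+j] p∤qC[1+j]

    [q+i]Cj≈iCj : ∀ i j → j < q → + ((q + i) C j) ≈ + (i C j)
    [q+i]Cj≈iCj zero    zero    _   = ≈-reflexive (cong (λ n → + (n C 0)) (+-identityʳ q))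
    [q+i]Cj≈iCj zero    (suc j) j<q = ≈-trans (≈-reflexive (cong (λ n → + (n C suc j)) (+-identityʳ q))) (∣⇒+≈0 (p∣qC[1+j] j<q))
    [q+i]Cj≈iCj (suc i) zero    _   = ≈-refl
    [q+i]Cj≈iCj (suc i) (suc j) j<q = begin
      + ((q + suc i) C suc j)                  ≡⟨ cong (λ n → + (n C suc j)) (+-suc q i) ⟩
      + (suc (q + i) C suc j)                  ≡⟨ cong +_ (sym (nCk+nC[k+1]≡[n+1]C[k+1] (q + i) j)) ⟩
      + ((q + i) C j) ℤ.+ + ((q + i) C suc j)  ≈⟨ +-cong ([q+i]Cj≈iCj i j (<-trans (n<1+n j) j<q)) ([q+i]Cj≈iCj i (suc j) j<q) ⟩
      + (i C j) ℤ.+ + (i C suc j)              ≡⟨ cong +_ (nCk+nC[k+1]≡[n+1]C[k+1] i j) ⟩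
      + (suc i C suc j)                        ∎
      where open import Relation.Binary.Reasoning.Setoid ≈-setoid

    centralBinomial[q]≈2 : + centralBinomial q ≈ + 2
    centralBinomial[q]≈2 = begin
      + ((2 * q) C q)                                  ≡⟨ cong (λ n → + (n C q)) 2q≡1+[q+q-1] ⟩
      + (suc (q + q-1) C suc q-1)                      ≡⟨ cong +_ (sym (nCk+nC[k+1]≡[n+1]C[k+1] (q + q-1) q-1)) ⟩
      + ((q + q-1) C q-1) ℤ.+ + ((q + q-1) C q)       ≡⟨ cong (λ c → + ((q + q-1) C q-1) ℤ.+ + c) symmetry ⟩
      + ((q + q-1) C q-1) ℤ.+ + ((q + q-1) C q-1)     ≈⟨ +-cong ([q+i]Cj≈iCj q-1 q-1 (n<1+n q-1)) ([q+i]Cj≈iCj q-1 q-1 (n<1+n q-1)) ⟩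
      + (q-1 C q-1) ℤ.+ + (q-1 C q-1)                 ≡⟨ cong (λ c → + c ℤ.+ + c) (nCn≡1 q-1) ⟩
      + 2                                              ∎
      where
      open import Relation.Binary.Reasoning.Setoid ≈-setoid
      2q≡1+[q+q-1] : 2 * q ≡ suc (q + q-1)
      2q≡1+[q+q-1] = trans (cong (λ n → q + n) (+-identityʳ q)) (+-suc q q-1)
      symmetry : (q + q-1) C q ≡ (q + q-1) C q-1
      symmetry = trans (nCk≡nC[n∸k] (m≤m+n q q-1)) (cong ((q + q-1) C_) (m+n∸m≡n q q-1))

    partialRowSum[q]≈1 : ∀ k → suc k ≤ q → + partialRowSum q (suc k) ≈ + 1
    partialRowSum[q]≈1 zero    _     = ≈-refl
    partialRowSum[q]≈1 (suc k) 1+k<q = begin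
      + partialRowSum q (suc k) ℤ.+ + (q C suc k)  ≈⟨ +-cong (partialRowSum[q]≈1 k (<⇒≤ 1+k<q)) (∣⇒+≈0 (p∣qC[1+j] 1+k<q)) ⟩
      + 1                                          ∎
      where open import Relation.Binary.Reasoning.Setoid ≈-setoid

    2^q≈2 : + (2 ^ q) ≈ + 2
    2^q≈2 = begin
      + (2 ^ q)                                  ≡⟨ cong +_ (sym (rowSum≡2^n q)) ⟩
      + partialRowSum q q ℤ.+ + (q C q)          ≈⟨ +-cong (partialRowSum[q]≈1 q-1 ≤-refl) (≈-reflexive (cong +_ (nCn≡1 q))) ⟩
      + 2                                        ∎
      where open import Relation.Binary.Reasoning.Setoid ≈-setoid

    [q-1]Cj²≈1 : ∀ j → j < q → + (q-1 C j) ℤ.* + (q-1 C j) ≈ + 1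
    [q-1]Cj²≈1 zero    _   = ≈-refl
    [q-1]Cj²≈1 (suc j) j<q = begin
      + (q-1 C suc j) ℤ.* + (q-1 C suc j)        ≈⟨ *-cong next≈-prev next≈-prev ⟩
      ℤ.- + (q-1 C j) ℤ.* ℤ.- + (q-1 C j)        ≡⟨ neg*neg (+ (q-1 C j)) ⟩
      + (q-1 C j) ℤ.* + (q-1 C j)                ≈⟨ [q-1]Cj²≈1 j (<-trans (n<1+n j) j<q) ⟩
      + 1                                        ∎
      where
      open import Relation.Binary.Reasoning.Setoid ≈-setoid
      neg*neg : ∀ x → ℤ.- x ℤ.* ℤ.- x ≡ x ℤ.* x
      neg*neg = ℤ-Solver.solve-∀
      shift : ∀ x y → y ≡ (x ℤ.+ y) ℤ.- x
      shift = ℤ-Solver.solve-∀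
      next≈-prev : + (q-1 C suc j) ≈ ℤ.- + (q-1 C j)
      next≈-prev = begin
        + (q-1 C suc j)                                   ≡⟨ shift (+ (q-1 C j)) (+ (q-1 C suc j)) ⟩
        + (q-1 C j ℕ.+ q-1 C suc j) ℤ.- + (q-1 C j)       ≡⟨ cong (λ c → + c ℤ.- + (q-1 C j)) (nCk+nC[k+1]≡[n+1]C[k+1] q-1 j) ⟩
        + (q C suc j) ℤ.- + (q-1 C j)                     ≈⟨ -‿cong₂ (∣⇒+≈0 (p∣qC[1+j] j<q)) (≈-refl {+ (q-1 C j)}) ⟩
        + 0 ℤ.- + (q-1 C j)                               ≡⟨ ℤ.+-identityˡ _ ⟩
        ℤ.- + (q-1 C j)                                   ∎

module OddPrimePowers where
  open import Data.Nat using (ℕ; zero; suc; _*_; _^_)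
  open import Data.Nat.Properties using (≤∧≢⇒<; *-comm)
  open import Data.Nat.Divisibility using (_∣_; divides; ∣⇒≤; ∣1⇒≡1)
  open import Data.Nat.Primality using (Prime; prime[2]; euclidsLemma; prime⇒nonZero)
  open import Data.Nat.Divisibility.Core using (hasNonTrivialDivisor)
  open import Data.Nat.Tactic.RingSolver using (solve-∀)
  open import Data.Product using (∃-syntax; _,_)
  open import Data.Sum using (_⊎_; inj₁; inj₂)
  open import Data.Empty using (⊥-elim)
  open import Function using (_∘_)
  open import Relation.Nullary using (¬_)
  open import Relation.Binary.PropositionalEquality

  even⊎odd : ∀ n → (∃[ m ] n ≡ 2 * m) ⊎ (∃[ m ] n ≡ suc (2 * m))
  even⊎odd zero    = inj₁ (0 , refl)
  even⊎odd (suc n) with even⊎odd n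
  ... | inj₁ (m , n≡2m)   = inj₂ (m , cong suc n≡2m)
  ... | inj₂ (m , n≡1+2m) = inj₁ (suc m , trans (cong suc n≡1+2m) (2+2m≡2[1+m] m))
    where
    2+2m≡2[1+m] : ∀ m → suc (suc (2 * m)) ≡ 2 * suc m
    2+2m≡2[1+m] = solve-∀

  module _ {p : ℕ} (p-prime : Prime p) (p≢2 : p ≢ 2) where

    2∤p : ¬ 2 ∣ p
    2∤p 2∣p = Prime.notComposite p-prime (hasNonTrivialDivisor (≤∧≢⇒< (∣⇒≤ 2∣p) (p≢2 ∘ sym)) 2∣p)
      where instance _ = prime⇒nonZero p-prime

    2∤p^r : ∀ r → ¬ 2 ∣ p ^ r
    2∤p^r zero    2∣1 with () ← ∣1⇒≡1 2∣1
    2∤p^r (suc r) 2∣p^[1+r] with euclidsLemma p (p ^ r) prime[2] 2∣p^[1+r]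
    ... | inj₁ 2∣p   = 2∤p 2∣p
    ... | inj₂ 2∣p^r = 2∤p^r r 2∣p^r

    p^r-odd : ∀ r → ∃[ m ] suc (2 * m) ≡ p ^ r
    p^r-odd r with even⊎odd (p ^ r)
    ... | inj₁ (m , p^r≡2m)   = ⊥-elim (2∤p^r r (divides m (trans p^r≡2m (*-comm 2 m))))
    ... | inj₂ (m , p^r≡1+2m) = m , sym p^r≡1+2m

module RationalArithmetic where
  open import Data.Nat as ℕ using (ℕ; suc)
  open import Data.Nat.Properties using (m*n≢0; *-identityʳ)
  open import Data.Integer as ℤ using (ℤ; +_)
  open import Data.Rational as ℚ using (ℚ; _/_; toℚᵘ)
  open import Data.Rational.Properties using (toℚᵘ-fromℚᵘ; fromℚᵘ-cong; toℚᵘ-injective; toℚᵘ-homo-+; toℚᵘ-homo-*; toℚᵘ-homo‿-)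
  open import Data.Rational.Unnormalised as ℚᵘ using (mkℚᵘ; *≡*)
  import Data.Rational.Unnormalised.Properties as ℚᵘ
  import Data.Integer.Tactic.RingSolver as ℤ-Solver
  open import Relation.Binary.PropositionalEquality

  private
    toℚᵘ-/ : ∀ a d → toℚᵘ (a / suc d) ℚᵘ.≃ mkℚᵘ a d
    toℚᵘ-/ a d = toℚᵘ-fromℚᵘ (mkℚᵘ a d)

  *≡*⇒/≡/ : ∀ a b d e .{{_ : ℕ.NonZero d}} .{{_ : ℕ.NonZero e}} → a ℤ.* + e ≡ b ℤ.* + d → a / d ≡ b / e
  *≡*⇒/≡/ a b (suc d) (suc e) eq = fromℚᵘ-cong {mkℚᵘ a d} {mkℚᵘ b e} (*≡* eq)

  /-+-/ : ∀ a b d e .{{_ : ℕ.NonZero d}} .{{_ : ℕ.NonZero e}} →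
          a / d ℚ.+ b / e ≡ ((a ℤ.* + e ℤ.+ b ℤ.* + d) / (d ℕ.* e)) {{m*n≢0 d e}}
  /-+-/ a b (suc d) (suc e) = toℚᵘ-injective (ℚᵘ.≃-trans (toℚᵘ-homo-+ (a / suc d) (b / suc e))
    (ℚᵘ.≃-trans (ℚᵘ.+-cong (toℚᵘ-/ a d) (toℚᵘ-/ b e)) (ℚᵘ.≃-sym (toℚᵘ-/ _ _))))

  /-*-/ : ∀ a b d e .{{_ : ℕ.NonZero d}} .{{_ : ℕ.NonZero e}} →
          (a / d) ℚ.* (b / e) ≡ ((a ℤ.* b) / (d ℕ.* e)) {{m*n≢0 d e}}
  /-*-/ a b (suc d) (suc e) = toℚᵘ-injective (ℚᵘ.≃-trans (toℚᵘ-homo-* (a / suc d) (b / suc e))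
    (ℚᵘ.≃-trans (ℚᵘ.*-cong (toℚᵘ-/ a d) (toℚᵘ-/ b e)) (ℚᵘ.≃-sym (toℚᵘ-/ _ _))))

  -‿/ : ∀ a d .{{_ : ℕ.NonZero d}} → ℚ.- (a / d) ≡ (ℤ.- a) / d
  -‿/ a (suc d) = toℚᵘ-injective (ℚᵘ.≃-trans (toℚᵘ-homo‿- (a / suc d))
    (ℚᵘ.≃-trans (ℚᵘ.-‿cong (toℚᵘ-/ a d)) (ℚᵘ.≃-sym (toℚᵘ-/ _ _))))

  [a/d-c]*d≡a-c*d : ∀ a c d .{{_ : ℕ.NonZero d}} → (a / d ℚ.- c / 1) ℚ.* (+ d / 1) ≡ (a ℤ.- c ℤ.* + d) / 1
  [a/d-c]*d≡a-c*d a c d = begin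
    (a / d ℚ.+ ℚ.- (c / 1)) ℚ.* (+ d / 1)                        ≡⟨ cong (λ x → (a / d ℚ.+ x) ℚ.* (+ d / 1)) (-‿/ c 1) ⟩
    (a / d ℚ.+ (ℤ.- c) / 1) ℚ.* (+ d / 1)                        ≡⟨ cong (ℚ._* (+ d / 1)) (/-+-/ a (ℤ.- c) d 1) ⟩
    (sum / (d ℕ.* 1)) {{d*1≢0}} ℚ.* (+ d / 1)                    ≡⟨ /-*-/ sum (+ d) (d ℕ.* 1) 1 {{d*1≢0}} ⟩
    ((sum ℤ.* + d) / (d ℕ.* 1 ℕ.* 1)) {{m*n≢0 (d ℕ.* 1) 1 {{d*1≢0}}}}
                                                                 ≡⟨ *≡*⇒/≡/ (sum ℤ.* + d) (a ℤ.- c ℤ.* + d) (d ℕ.* 1 ℕ.* 1) 1 {{m*n≢0 (d ℕ.* 1) 1 {{d*1≢0}}}} cross ⟩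
    (a ℤ.- c ℤ.* + d) / 1                                        ∎
    where
    open ≡-Reasoning
    d*1≢0 = m*n≢0 d 1
    sum = a ℤ.* + 1 ℤ.+ ℤ.- c ℤ.* + d
    clear : ∀ a c x → ((a ℤ.* + 1 ℤ.+ ℤ.- c ℤ.* x) ℤ.* x) ℤ.* + 1 ≡ (a ℤ.- c ℤ.* x) ℤ.* x
    clear = ℤ-Solver.solve-∀
    cross : (sum ℤ.* + d) ℤ.* + 1 ≡ (a ℤ.- c ℤ.* + d) ℤ.* + (d ℕ.* 1 ℕ.* 1)
    cross = trans (clear a c (+ d)) (cong (λ x → (a ℤ.- c ℤ.* + d) ℤ.* + x) (sym (trans (*-identityʳ (d ℕ.* 1)) (*-identityʳ d))))

module IntegerPowers where
  open import Data.Nat as ℕ using (ℕ; zero; suc)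
  open import Data.Integer using (+_; _*_; _^_)
  open import Data.Integer.Properties using (pos-*)
  open import Data.Integer.Tactic.RingSolver using (solve-∀)
  open import Relation.Binary.PropositionalEquality using (_≡_; refl; cong; trans)

  pos-^ : ∀ (m n : ℕ) → + (m ℕ.^ n) ≡ (+ m) ^ n
  pos-^ m zero    = refl
  pos-^ m (suc n) = trans (pos-* m (m ℕ.^ n)) (cong (+ m *_) (pos-^ m n))

  ^-distribʳ-* : ∀ x y n → (x * y) ^ n ≡ x ^ n * y ^ n
  ^-distribʳ-* x y zero    = refl
  ^-distribʳ-* x y (suc n) = trans (cong ((x * y) *_) (^-distribʳ-* x y n)) (interchange x y (x ^ n) (y ^ n))
    where
    interchange : ∀ a b c d → (a * b) * (c * d) ≡ (a * c) * (b * d)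
    interchange = solve-∀

module ClosedForm where
  open import Defs
  open import Data.Nat as ℕ using (ℕ; zero; suc)
  open import Data.Nat.Properties using (m*n≢0)
  open import Data.Integer as ℤ using (ℤ; +_; _+_; _*_; _-_; _^_)
  open import Data.Integer.Properties using (pos-*)
  open import Data.Integer.Tactic.RingSolver using (solve-∀)
  open import Data.Rational as ℚ using (ℚ; _/_)
  open import Relation.Binary.PropositionalEquality
  open ≡-Reasoning
  open Binomial using (centralBinomial; centralBinomial-recurrence)
  open IntegerPowers
  open RationalArithmetic

  sumBelow-telescope : ∀ (f g : ℕ → ℚ) → f 0 ≡ ℚ.0ℚ → (∀ n → f n ℚ.+ g n ≡ f (suc n)) →
                       ∀ n → sumBelow n g ≡ f n
  sumBelow-telescope f g f0≡0 step zero    = sym f0≡0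
  sumBelow-telescope f g f0≡0 step (suc n) = trans (cong (ℚ._+ g n) (sumBelow-telescope f g f0≡0 step n)) (step n)

  closedFormPolynomial : ℤ → ℤ
  closedFormPolynomial x = + 8 * x * x - + 12 * x + + 3

  closedFormNumerator : ℕ → ℤ
  closedFormNumerator n = + 16 * (+ n) ^ 4 * closedFormPolynomial (+ n) * (+ centralBinomial n) ^ 4

  closedForm : ℕ → ℚ
  closedForm n = (closedFormNumerator n / denom n) {{denom-nz n}}

  closedForm-certificate : ∀ n → closedFormPolynomial (+ suc n) * (+ absOdd n) ^ 4
                                 ≡ + 16 * (+ n) ^ 4 * closedFormPolynomial (+ n) + (+ 4 * + n - + 1) ^ 3
  closedForm-certificate zero    = refl
  closedForm-certificate (suc k) = begin
    closedFormPolynomial (+ 1 + (+ 1 + + k)) * (+ 1 + + (2 ℕ.* k)) ^ 4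
      ≡⟨ cong (λ y → closedFormPolynomial (+ 1 + (+ 1 + + k)) * (+ 1 + y) ^ 4) (pos-* 2 k) ⟩
    closedFormPolynomial (+ 1 + (+ 1 + + k)) * (+ 1 + + 2 * + k) ^ 4
      ≡⟨ identity (+ k) ⟩
    + 16 * (+ 1 + + k) ^ 4 * closedFormPolynomial (+ 1 + + k) + (+ 4 * (+ 1 + + k) - + 1) ^ 3 ∎
    where
    identity : ∀ x →
      (+ 8 * (+ 1 + (+ 1 + x)) * (+ 1 + (+ 1 + x)) - + 12 * (+ 1 + (+ 1 + x)) + + 3)
        * ((+ 1 + + 2 * x) * ((+ 1 + + 2 * x) * ((+ 1 + + 2 * x) * ((+ 1 + + 2 * x) * + 1))))
      ≡ + 16 * ((+ 1 + x) * ((+ 1 + x) * ((+ 1 + x) * ((+ 1 + x) * + 1))))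
             * (+ 8 * (+ 1 + x) * (+ 1 + x) - + 12 * (+ 1 + x) + + 3)
        + (+ 4 * (+ 1 + x) - + 1) * ((+ 4 * (+ 1 + x) - + 1) * ((+ 4 * (+ 1 + x) - + 1) * + 1))
    identity = solve-∀

  telescoping-identity : ∀ (N4 P E c4 M4 P′ c′4 A4 B4 X : ℤ) →
    P′ * A4 ≡ + 16 * N4 * P + E →
    M4 * c′4 ≡ + 16 * B4 * c4 →
    (+ 16 * N4 * P * c4 * (X * A4) + E * c4 * (X * A4)) * (+ 256 * X * B4)
      ≡ + 16 * M4 * P′ * c′4 * ((X * A4) * (X * A4))
  telescoping-identity N4 P E c4 M4 P′ c′4 A4 B4 X certificate recurrence = begin
    (+ 16 * N4 * P * c4 * (X * A4) + E * c4 * (X * A4)) * (+ 256 * X * B4)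
      ≡⟨ factor N4 P E c4 X A4 B4 ⟩
    (+ 16 * N4 * P + E) * (c4 * (X * A4) * (+ 256 * X * B4))
      ≡⟨ cong (_* (c4 * (X * A4) * (+ 256 * X * B4))) (sym certificate) ⟩
    P′ * A4 * (c4 * (X * A4) * (+ 256 * X * B4))
      ≡⟨ regroup P′ A4 c4 X B4 ⟩
    + 16 * (+ 16 * B4 * c4) * P′ * ((X * A4) * (X * A4))
      ≡⟨ cong (λ y → + 16 * y * P′ * ((X * A4) * (X * A4))) (sym recurrence) ⟩
    + 16 * (M4 * c′4) * P′ * ((X * A4) * (X * A4))
      ≡⟨ reorder M4 c′4 P′ (X * A4) ⟩
    + 16 * M4 * P′ * c′4 * ((X * A4) * (X * A4)) ∎
    where
    factor : ∀ N4 P E c4 X A4 B4 → (+ 16 * N4 * P * c4 * (X * A4) + E * c4 * (X * A4)) * (+ 256 * X * B4)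
                                   ≡ (+ 16 * N4 * P + E) * (c4 * (X * A4) * (+ 256 * X * B4))
    factor = solve-∀
    regroup : ∀ P′ A4 c4 X B4 → P′ * A4 * (c4 * (X * A4) * (+ 256 * X * B4))
                               ≡ + 16 * (+ 16 * B4 * c4) * P′ * ((X * A4) * (X * A4))
    regroup = solve-∀
    reorder : ∀ M4 c′4 P′ D → + 16 * (M4 * c′4) * P′ * (D * D) ≡ + 16 * M4 * P′ * c′4 * (D * D)
    reorder = solve-∀

  centralBinomial⁴-recurrence : ∀ n → (+ suc n) ^ 4 * (+ centralBinomial (suc n)) ^ 4
                                      ≡ + 16 * (+ suc (2 ℕ.* n)) ^ 4 * (+ centralBinomial n) ^ 4
  centralBinomial⁴-recurrence n = begin
    (+ suc n) ^ 4 * (+ centralBinomial (suc n)) ^ 4        ≡⟨ sym (^-distribʳ-* (+ suc n) (+ centralBinomial (suc n)) 4) ⟩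
    (+ suc n * + centralBinomial (suc n)) ^ 4          ≡⟨ cong (_^ 4) cast-recurrence ⟩
    (+ 2 * + suc (2 ℕ.* n) * + centralBinomial n) ^ 4  ≡⟨ ^-distribʳ-* (+ 2 * + suc (2 ℕ.* n)) (+ centralBinomial n) 4 ⟩
    (+ 2 * + suc (2 ℕ.* n)) ^ 4 * (+ centralBinomial n) ^ 4
                                                        ≡⟨ cong (_* (+ centralBinomial n) ^ 4) (^-distribʳ-* (+ 2) (+ suc (2 ℕ.* n)) 4) ⟩
    + 16 * (+ suc (2 ℕ.* n)) ^ 4 * (+ centralBinomial n) ^ 4 ∎
    where
    cast-recurrence : + suc n * + centralBinomial (suc n) ≡ + 2 * + suc (2 ℕ.* n) * + centralBinomial n
    cast-recurrence = begin
      + suc n * + centralBinomial (suc n)             ≡⟨ sym (pos-* (suc n) _) ⟩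
      + (suc n ℕ.* centralBinomial (suc n))           ≡⟨ cong +_ (centralBinomial-recurrence n) ⟩
      + (2 ℕ.* suc (2 ℕ.* n) ℕ.* centralBinomial n)  ≡⟨ pos-* (2 ℕ.* suc (2 ℕ.* n)) _ ⟩
      + (2 ℕ.* suc (2 ℕ.* n)) * + centralBinomial n  ≡⟨ cong (_* + centralBinomial n) (pos-* 2 (suc (2 ℕ.* n))) ⟩
      + 2 * + suc (2 ℕ.* n) * + centralBinomial n    ∎

  denom≡ : ∀ n → + denom n ≡ + (256 ℕ.^ n) * (+ absOdd n) ^ 4
  denom≡ n = trans (pos-* (256 ℕ.^ n) _) (cong (+ (256 ℕ.^ n) *_) (pos-^ (absOdd n) 4))

  closedForm-step : ∀ n → closedForm n ℚ.+ term n ≡ closedForm (suc n)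
  closedForm-step n =
    trans (/-+-/ (closedFormNumerator n) (termNumerator) (denom n) (denom n) {{denom-nz n}} {{denom-nz n}})
          (*≡*⇒/≡/ (closedFormNumerator n * + denom n + termNumerator * + denom n) (closedFormNumerator (suc n)) (denom n ℕ.* denom n) (denom (suc n))
                   {{m*n≢0 (denom n) (denom n) {{denom-nz n}} {{denom-nz n}}}} {{denom-nz (suc n)}} cross)
    where
    termNumerator = (+ 4 * + n - + 1) ^ 3 * + (centralBinomial n ℕ.^ 4)
    X = + (256 ℕ.^ n)
    A4 = (+ absOdd n) ^ 4
    cross : (closedFormNumerator n * + denom n + termNumerator * + denom n) * + denom (suc n)
            ≡ closedFormNumerator (suc n) * + (denom n ℕ.* denom n)
    cross = begin
      (closedFormNumerator n * + denom n + termNumerator * + denom n) * + denom (suc n)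
        ≡⟨ cong₂ (λ D c4 → (closedFormNumerator n * D + (+ 4 * + n - + 1) ^ 3 * c4 * D) * + denom (suc n))
                 (denom≡ n) (pos-^ (centralBinomial n) 4) ⟩
      (closedFormNumerator n * (X * A4) + (+ 4 * + n - + 1) ^ 3 * (+ centralBinomial n) ^ 4 * (X * A4)) * + denom (suc n)
        ≡⟨ cong (λ D → (closedFormNumerator n * (X * A4) + (+ 4 * + n - + 1) ^ 3 * (+ centralBinomial n) ^ 4 * (X * A4)) * D)
                (trans (denom≡ (suc n)) (cong (_* (+ suc (2 ℕ.* n)) ^ 4) (pos-* 256 (256 ℕ.^ n)))) ⟩
      (closedFormNumerator n * (X * A4) + (+ 4 * + n - + 1) ^ 3 * (+ centralBinomial n) ^ 4 * (X * A4)) * (+ 256 * X * (+ suc (2 ℕ.* n)) ^ 4)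
        ≡⟨ telescoping-identity ((+ n) ^ 4) (closedFormPolynomial (+ n)) ((+ 4 * + n - + 1) ^ 3) ((+ centralBinomial n) ^ 4)
                          ((+ suc n) ^ 4) (closedFormPolynomial (+ suc n)) ((+ centralBinomial (suc n)) ^ 4)
                          A4 ((+ suc (2 ℕ.* n)) ^ 4) X
                          (closedForm-certificate n) (centralBinomial⁴-recurrence n) ⟩
      closedFormNumerator (suc n) * ((X * A4) * (X * A4))
        ≡⟨ cong (closedFormNumerator (suc n) *_) (sym (trans (pos-* (denom n) (denom n)) (cong₂ _*_ (denom≡ n) (denom≡ n)))) ⟩
      closedFormNumerator (suc n) * + (denom n ℕ.* denom n) ∎

  sumBelow-term≡closedForm : ∀ n → sumBelow n term ≡ closedForm n
  sumBelow-term≡closedForm = sumBelow-telescope closedForm term refl closedForm-step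

module Corollary (p : ℕ) (p-prime : Prime p) (p≢2 : p ≢ 2) where
  open import Defs
  open import Data.Nat as ℕ using (ℕ; suc; _+_; _*_; _^_)
  open import Data.Nat.Properties
  open import Data.Nat.Divisibility
  open import Data.Nat.DivMod using (m*n/n≡m)
  open import Data.Nat.Primality using (prime⇒nonTrivial)
  import Data.Nat.Tactic.RingSolver as ℕ-Solver
  open import Data.Integer as ℤ using (ℤ; +_)
  import Data.Integer.Properties as ℤ
  import Data.Integer.Divisibility.Signed as Signed
  import Data.Integer.Tactic.RingSolver as ℤ-Solver
  open import Data.Rational using (_/_)
  open import Data.Product using (_,_)
  open import Function using (_∘_)
  open import Relation.Nullary using (¬_)
  open import Relation.Binary.PropositionalEquality
  open Binomial using (centralBinomial)
  open ModuloPrime p p-prime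
  open IntegerPowers
  open RationalArithmetic using ([a/d-c]*d≡a-c*d)
  open ClosedForm

  p∤2 : ¬ p ∣ 2
  p∤2 p∣2 = <⇒≱ (≤∧≢⇒< (∣⇒≤ p∣2) p≢2) (ℕ.nonTrivial⇒n>1 p {{prime⇒nonTrivial p-prime}})

  p∤256^k : ∀ k → ¬ p ∣ 256 ^ k
  p∤256^k k p∣256^k = p∤m^k p∤2 (8 * k) (subst (p ∣_) (^-*-assoc 2 8 k) p∣256^k)

  /-congMod : ∀ k (a c : ℤ) d u e .{{_ : ℕ.NonZero d}} → ¬ p ∣ d → ¬ p ∣ u →
              (a ℤ.- c ℤ.* + d) ℤ.* + u ≡ + (p ^ k) ℤ.* e → e ≈ + 0 →
              CongMod (a / d) (c / 1) p (suc k)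
  /-congMod k a c d u e p∤d p∤u factorisation e≈0 =
    a ℤ.- c ℤ.* + d , + d , p∤d , p^[1+k]∣a-cd , [a/d-c]*d≡a-c*d a c d
    where
    t = Signed.quotient (≈0⇒∣ e≈0)
    p^[1+k]∣[a-cd]*u : + (p ^ suc k) Signed.∣ (a ℤ.- c ℤ.* + d) ℤ.* + u
    p^[1+k]∣[a-cd]*u = Signed.divides t (begin
      (a ℤ.- c ℤ.* + d) ℤ.* + u  ≡⟨ factorisation ⟩
      + (p ^ k) ℤ.* e            ≡⟨ cong (+ (p ^ k) ℤ.*_) (Signed._∣_.equality (≈0⇒∣ e≈0)) ⟩
      + (p ^ k) ℤ.* (t ℤ.* + p)  ≡⟨ reassoc (+ (p ^ k)) t (+ p) ⟩
      t ℤ.* (+ p ℤ.* + (p ^ k))  ≡⟨ cong (t ℤ.*_) (sym (ℤ.pos-* p (p ^ k))) ⟩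
      t ℤ.* + (p ^ suc k)        ∎)
      where
      open ≡-Reasoning
      reassoc : ∀ x t y → x ℤ.* (t ℤ.* y) ≡ t ℤ.* (y ℤ.* x)
      reassoc = ℤ-Solver.solve-∀
    p^[1+k]∣a-cd : p ^ suc k ∣ ℤ.∣ a ℤ.- c ℤ.* + d ∣
    p^[1+k]∣a-cd = p^k∣m*n∧p∤n⇒p^k∣m (suc k)
      (subst (p ^ suc k ∣_) (ℤ.abs-* (a ℤ.- c ℤ.* + d) (+ u)) (Signed.∣⇒∣ᵤ p^[1+k]∣[a-cd]*u)) p∤u

  closedFormPolynomial-cong : ∀ {x y} → x ≈ y → closedFormPolynomial x ≈ closedFormPolynomial y
  closedFormPolynomial-cong x≈y =
    +-cong (-‿cong₂ (*-cong (*-cong (≈-refl {+ 8}) x≈y) x≈y) (*-cong (≈-refl {+ 12}) x≈y)) (≈-refl {+ 3})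

  256^n≡[2^n]^8 : ∀ n → 256 ^ n ≡ (2 ^ n) ^ 8
  256^n≡[2^n]^8 n = trans (^-*-assoc 2 8 n) (trans (cong (2 ^_) (*-comm 8 n)) (sym (^-*-assoc 2 n 8)))

  16*256^m≡[2^[1+2m]]^4 : ∀ m → 16 * 256 ^ m ≡ (2 ^ suc (2 * m)) ^ 4
  16*256^m≡[2^[1+2m]]^4 m = begin
    16 * 256 ^ m              ≡⟨ cong (16 *_) (^-*-assoc 2 8 m) ⟩
    2 ^ 4 * 2 ^ (8 * m)       ≡⟨ sym (^-distribˡ-+-* 2 4 (8 * m)) ⟩
    2 ^ (4 + 8 * m)           ≡⟨ cong (2 ^_) (exponent m) ⟩
    2 ^ (suc (2 * m) * 4)     ≡⟨ sym (^-*-assoc 2 (suc (2 * m)) 4) ⟩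
    (2 ^ suc (2 * m)) ^ 4     ∎
    where
    open ≡-Reasoning
    exponent : ∀ m → 4 + 8 * m ≡ suc (2 * m) * 4
    exponent = ℕ-Solver.solve-∀

  +absOdd[1+k]≡2[1+k]-1 : ∀ k → + absOdd (suc k) ≡ + 2 ℤ.* + suc k ℤ.- + 1
  +absOdd[1+k]≡2[1+k]-1 k = trans (cong (λ y → + 1 ℤ.+ y) (ℤ.pos-* 2 k)) (rearrange (+ k))
    where
    rearrange : ∀ x → + 1 ℤ.+ + 2 ℤ.* x ≡ + 2 ℤ.* (+ 1 ℤ.+ x) ℤ.- + 1
    rearrange = ℤ-Solver.solve-∀

  two-step-factorisation : ∀ (M2⁴ P C2⁴ B4 C1⁴ M1⁴ Q4 C0⁴ X : ℤ) →
    M2⁴ ℤ.* C2⁴ ≡ + 16 ℤ.* B4 ℤ.* C1⁴ →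
    M1⁴ ℤ.* C1⁴ ≡ + 16 ℤ.* Q4 ℤ.* C0⁴ →
    (+ 16 ℤ.* M2⁴ ℤ.* P ℤ.* C2⁴ ℤ.- + 3 ℤ.* Q4 ℤ.* (+ 256 ℤ.* (+ 256 ℤ.* X) ℤ.* B4)) ℤ.* (+ 16 ℤ.* M1⁴)
      ≡ Q4 ℤ.* (+ 65536 ℤ.* B4 ℤ.* (P ℤ.* C0⁴ ℤ.- + 3 ℤ.* (+ 16 ℤ.* X ℤ.* M1⁴)))
  two-step-factorisation M2⁴ P C2⁴ B4 C1⁴ M1⁴ Q4 C0⁴ X recurrence₂ recurrence₁ = begin
    (+ 16 ℤ.* M2⁴ ℤ.* P ℤ.* C2⁴ ℤ.- R) ℤ.* (+ 16 ℤ.* M1⁴)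
      ≡⟨ regroup₂ M2⁴ P C2⁴ R M1⁴ ⟩
    + 256 ℤ.* P ℤ.* (M2⁴ ℤ.* C2⁴) ℤ.* M1⁴ ℤ.- R ℤ.* (+ 16 ℤ.* M1⁴)
      ≡⟨ cong (λ y → + 256 ℤ.* P ℤ.* y ℤ.* M1⁴ ℤ.- R ℤ.* (+ 16 ℤ.* M1⁴)) recurrence₂ ⟩
    + 256 ℤ.* P ℤ.* (+ 16 ℤ.* B4 ℤ.* C1⁴) ℤ.* M1⁴ ℤ.- R ℤ.* (+ 16 ℤ.* M1⁴)
      ≡⟨ regroup₁ P B4 C1⁴ M1⁴ (R ℤ.* (+ 16 ℤ.* M1⁴)) ⟩
    + 4096 ℤ.* P ℤ.* B4 ℤ.* (M1⁴ ℤ.* C1⁴) ℤ.- R ℤ.* (+ 16 ℤ.* M1⁴)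
      ≡⟨ cong (λ y → + 4096 ℤ.* P ℤ.* B4 ℤ.* y ℤ.- R ℤ.* (+ 16 ℤ.* M1⁴)) recurrence₁ ⟩
    + 4096 ℤ.* P ℤ.* B4 ℤ.* (+ 16 ℤ.* Q4 ℤ.* C0⁴) ℤ.- R ℤ.* (+ 16 ℤ.* M1⁴)
      ≡⟨ factor P B4 Q4 C0⁴ X M1⁴ ⟩
    Q4 ℤ.* (+ 65536 ℤ.* B4 ℤ.* (P ℤ.* C0⁴ ℤ.- + 3 ℤ.* (+ 16 ℤ.* X ℤ.* M1⁴))) ∎
    where
    open ≡-Reasoning
    R = + 3 ℤ.* Q4 ℤ.* (+ 256 ℤ.* (+ 256 ℤ.* X) ℤ.* B4)
    regroup₂ : ∀ M2⁴ P C2⁴ R M1⁴ → (+ 16 ℤ.* M2⁴ ℤ.* P ℤ.* C2⁴ ℤ.- R) ℤ.* (+ 16 ℤ.* M1⁴)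
                                    ≡ + 256 ℤ.* P ℤ.* (M2⁴ ℤ.* C2⁴) ℤ.* M1⁴ ℤ.- R ℤ.* (+ 16 ℤ.* M1⁴)
    regroup₂ = ℤ-Solver.solve-∀
    regroup₁ : ∀ P B4 C1⁴ M1⁴ S → + 256 ℤ.* P ℤ.* (+ 16 ℤ.* B4 ℤ.* C1⁴) ℤ.* M1⁴ ℤ.- S
                                   ≡ + 4096 ℤ.* P ℤ.* B4 ℤ.* (M1⁴ ℤ.* C1⁴) ℤ.- S
    regroup₁ = ℤ-Solver.solve-∀
    factor : ∀ P B4 Q4 C0⁴ X M1⁴ →
      + 4096 ℤ.* P ℤ.* B4 ℤ.* (+ 16 ℤ.* Q4 ℤ.* C0⁴) ℤ.- + 3 ℤ.* Q4 ℤ.* (+ 256 ℤ.* (+ 256 ℤ.* X) ℤ.* B4) ℤ.* (+ 16 ℤ.* M1⁴)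
        ≡ Q4 ℤ.* (+ 65536 ℤ.* B4 ℤ.* (P ℤ.* C0⁴ ℤ.- + 3 ℤ.* (+ 16 ℤ.* X ℤ.* M1⁴)))
    factor = ℤ-Solver.solve-∀

  module OddPrimePower (m r′ : ℕ) (q≡p^r : suc (2 * m) ≡ p ^ suc r′) where
    r = suc r′

    open PrimePower (2 * m) r q≡p^r

    Q = + q

    p∣q : p ∣ q
    p∣q = subst (p ∣_) (sym q≡p^r) (m∣m*n (p ^ r′))

    Q≈0 : Q ≈ + 0
    Q≈0 = ∣⇒+≈0 p∣q

    p∤q+k : ∀ {k} → ¬ p ∣ k → ¬ p ∣ q + k
    p∤q+k p∤k p∣q+k = p∤k (∣m+n∣m⇒∣n p∣q+k p∣q)

    +p^[4r]≡Q^4 : + (p ^ (4 * r)) ≡ Q ℤ.^ 4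
    +p^[4r]≡Q^4 = begin
      + (p ^ (4 * r))  ≡⟨ cong (λ e → + (p ^ e)) (*-comm 4 r) ⟩
      + (p ^ (r * 4))  ≡⟨ cong +_ (sym (^-*-assoc p r 4)) ⟩
      + ((p ^ r) ^ 4)  ≡⟨ cong (λ n → + (n ^ 4)) (sym q≡p^r) ⟩
      + (q ^ 4)        ≡⟨ pos-^ q 4 ⟩
      Q ℤ.^ 4          ∎
      where open ≡-Reasoning

    +3p^[4r]≡3Q^4 : + (3 * p ^ (4 * r)) ≡ + 3 ℤ.* Q ℤ.^ 4
    +3p^[4r]≡3Q^4 = trans (ℤ.pos-* 3 (p ^ (4 * r))) (cong (+ 3 ℤ.*_) +p^[4r]≡Q^4)

    p∤denom[q] : ¬ p ∣ denom q
    p∤denom[q] = p∤m*n (p∤256^k q) (p∤m^k p∤2q-1 4)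
      where
      2q-1+1≡2q : ∀ m → suc (2 * (2 * m)) + 1 ≡ 2 * suc (2 * m)
      2q-1+1≡2q = ℕ-Solver.solve-∀
      p∤2q-1 : ¬ p ∣ absOdd q
      p∤2q-1 p∣2q-1 = p∤1 (∣m+n∣m⇒∣n (subst (p ∣_) (sym (2q-1+1≡2q m)) (∣n⇒∣m*n 2 p∣q)) p∣2q-1)

    cofactor[q] : ℤ
    cofactor[q] = + 16 ℤ.* closedFormPolynomial Q ℤ.* (+ centralBinomial q) ℤ.^ 4
                    ℤ.- + 3 ℤ.* (+ (256 ^ q) ℤ.* (+ absOdd q) ℤ.^ 4)

    numerator[q]-factorisation : (closedFormNumerator q ℤ.- + (3 * p ^ (4 * r)) ℤ.* + denom q) ℤ.* + 1
                                 ≡ + (p ^ (4 * r)) ℤ.* cofactor[q]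
    numerator[q]-factorisation = begin
      (closedFormNumerator q ℤ.- + (3 * p ^ (4 * r)) ℤ.* + denom q) ℤ.* + 1
        ≡⟨ cong₂ (λ c D → (closedFormNumerator q ℤ.- c ℤ.* D) ℤ.* + 1) +3p^[4r]≡3Q^4 (denom≡ q) ⟩
      (+ 16 ℤ.* Q ℤ.^ 4 ℤ.* P ℤ.* C4 ℤ.- + 3 ℤ.* Q ℤ.^ 4 ℤ.* (X ℤ.* A4)) ℤ.* + 1
        ≡⟨ factor (Q ℤ.^ 4) P C4 X A4 ⟩
      Q ℤ.^ 4 ℤ.* (+ 16 ℤ.* P ℤ.* C4 ℤ.- + 3 ℤ.* (X ℤ.* A4))
        ≡⟨ cong (ℤ._* (+ 16 ℤ.* P ℤ.* C4 ℤ.- + 3 ℤ.* (X ℤ.* A4))) (sym +p^[4r]≡Q^4) ⟩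
      + (p ^ (4 * r)) ℤ.* (+ 16 ℤ.* P ℤ.* C4 ℤ.- + 3 ℤ.* (X ℤ.* A4)) ∎
      where
      open ≡-Reasoning
      P = closedFormPolynomial Q
      C4 = (+ centralBinomial q) ℤ.^ 4
      X = + (256 ^ q)
      A4 = (+ absOdd q) ℤ.^ 4
      factor : ∀ Q4 P C4 X A4 → (+ 16 ℤ.* Q4 ℤ.* P ℤ.* C4 ℤ.- + 3 ℤ.* Q4 ℤ.* (X ℤ.* A4)) ℤ.* + 1
                                ≡ Q4 ℤ.* (+ 16 ℤ.* P ℤ.* C4 ℤ.- + 3 ℤ.* (X ℤ.* A4))
      factor = ℤ-Solver.solve-∀

    cofactor[q]≈0 : cofactor[q] ≈ + 0
    cofactor[q]≈0 = -‿cong₂ (*-cong (*-cong (≈-refl {+ 16}) (closedFormPolynomial-cong Q≈0)) (^-cong centralBinomial[q]≈2 4))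
                                (*-cong (≈-refl {+ 3}) (*-cong 256^q≈256 (^-cong 2q-1≈-1 4)))
      where
      open import Relation.Binary.Reasoning.Setoid ≈-setoid
      256^q≈256 : + (256 ^ q) ≈ + 256
      256^q≈256 = begin
        + (256 ^ q)        ≡⟨ cong +_ (256^n≡[2^n]^8 q) ⟩
        + ((2 ^ q) ^ 8)    ≡⟨ pos-^ (2 ^ q) 8 ⟩
        (+ (2 ^ q)) ℤ.^ 8  ≈⟨ ^-cong 2^q≈2 8 ⟩
        + 256              ∎
      2q-1≈-1 : + absOdd q ≈ ℤ.- + 1
      2q-1≈-1 = begin
        + absOdd q                  ≡⟨ +absOdd[1+k]≡2[1+k]-1 (2 * m) ⟩
        + 2 ℤ.* Q ℤ.- + 1           ≈⟨ -‿cong₂ (*-cong (≈-refl {+ 2}) Q≈0) (≈-refl {+ 1}) ⟩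
        ℤ.- + 1                     ∎

    closedForm[q]-congruence : CongMod (closedForm q) ((+ (3 * p ^ (4 * r))) / 1) p (suc (4 * r))
    closedForm[q]-congruence = /-congMod (4 * r) (closedFormNumerator q) (+ (3 * p ^ (4 * r))) (denom q) 1 cofactor[q]
      {{denom-nz q}} p∤denom[q] p∤1 numerator[q]-factorisation cofactor[q]≈0

    n₂ : ℕ
    n₂ = suc (suc m)

    -- Multiplying by the p-unit u₂ = (q+1)⁴ lets the recurrence turn (m+1)⁴ C(2m+2,m+1)⁴ into 16 q⁴ C(2m,m)⁴.
    u₂ : ℕ
    u₂ = (2 * suc m) ^ 4

    2[1+m]≡q+1 : 2 * suc m ≡ q + 1
    2[1+m]≡q+1 = identity m
      where
      identity : ∀ m → 2 * suc m ≡ suc (2 * m) + 1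
      identity = ℕ-Solver.solve-∀

    cofactor[n₂] : ℤ
    cofactor[n₂] = + 65536 ℤ.* (+ absOdd n₂) ℤ.^ 4
                     ℤ.* (closedFormPolynomial (+ n₂) ℤ.* (+ centralBinomial m) ℤ.^ 4
                          ℤ.- + 3 ℤ.* (+ 16 ℤ.* + (256 ^ m) ℤ.* (+ suc m) ℤ.^ 4))

    numerator[n₂]-factorisation : (closedFormNumerator n₂ ℤ.- + (3 * p ^ (4 * r)) ℤ.* + denom n₂) ℤ.* + u₂
                                  ≡ + (p ^ (4 * r)) ℤ.* cofactor[n₂]
    numerator[n₂]-factorisation = begin
      (closedFormNumerator n₂ ℤ.- + (3 * p ^ (4 * r)) ℤ.* + denom n₂) ℤ.* + u₂
        ≡⟨ cong₂ (λ c D → (closedFormNumerator n₂ ℤ.- c ℤ.* D) ℤ.* + u₂) +3p^[4r]≡3Q^4 +denom[n₂]≡ ⟩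
      (closedFormNumerator n₂ ℤ.- + 3 ℤ.* Q ℤ.^ 4 ℤ.* (+ 256 ℤ.* (+ 256 ℤ.* X) ℤ.* B4)) ℤ.* + u₂
        ≡⟨ cong ((closedFormNumerator n₂ ℤ.- + 3 ℤ.* Q ℤ.^ 4 ℤ.* (+ 256 ℤ.* (+ 256 ℤ.* X) ℤ.* B4)) ℤ.*_) +u₂≡16[1+m]^4 ⟩
      (closedFormNumerator n₂ ℤ.- + 3 ℤ.* Q ℤ.^ 4 ℤ.* (+ 256 ℤ.* (+ 256 ℤ.* X) ℤ.* B4)) ℤ.* (+ 16 ℤ.* (+ suc m) ℤ.^ 4)
        ≡⟨ two-step-factorisation ((+ n₂) ℤ.^ 4) (closedFormPolynomial (+ n₂)) ((+ centralBinomial n₂) ℤ.^ 4) B4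
             ((+ centralBinomial (suc m)) ℤ.^ 4) ((+ suc m) ℤ.^ 4) (Q ℤ.^ 4) ((+ centralBinomial m) ℤ.^ 4) X
             (centralBinomial⁴-recurrence (suc m)) (centralBinomial⁴-recurrence m) ⟩
      Q ℤ.^ 4 ℤ.* cofactor[n₂]
        ≡⟨ cong (ℤ._* cofactor[n₂]) (sym +p^[4r]≡Q^4) ⟩
      + (p ^ (4 * r)) ℤ.* cofactor[n₂] ∎
      where
      open ≡-Reasoning
      X = + (256 ^ m)
      B4 = (+ absOdd n₂) ℤ.^ 4
      +denom[n₂]≡ : + denom n₂ ≡ + 256 ℤ.* (+ 256 ℤ.* X) ℤ.* B4
      +denom[n₂]≡ = trans (denom≡ n₂) (cong (ℤ._* B4)
        (trans (ℤ.pos-* 256 (256 * 256 ^ m)) (cong (+ 256 ℤ.*_) (ℤ.pos-* 256 (256 ^ m)))))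
      +u₂≡16[1+m]^4 : + u₂ ≡ + 16 ℤ.* (+ suc m) ℤ.^ 4
      +u₂≡16[1+m]^4 = trans (pos-^ (2 * suc m) 4)
        (trans (cong (ℤ._^ 4) (ℤ.pos-* 2 (suc m))) (^-distribʳ-* (+ 2) (+ suc m) 4))

    cofactor[n₂]≈0 : cofactor[n₂] ≈ + 0
    cofactor[n₂]≈0 = begin
      cofactor[n₂]
        ≈⟨ *-cong (≈-refl {+ 65536 ℤ.* (+ absOdd n₂) ℤ.^ 4}) (-‿cong₂ (*-cong P≈3 C⁴≈1) (*-cong (≈-refl {+ 3}) 16*256^m*[1+m]^4≈1)) ⟩
      + 65536 ℤ.* (+ absOdd n₂) ℤ.^ 4 ℤ.* (+ 3 ℤ.* + 1 ℤ.- + 3 ℤ.* + 1)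
        ≡⟨ ℤ.*-zeroʳ (+ 65536 ℤ.* (+ absOdd n₂) ℤ.^ 4) ⟩
      + 0 ∎
      where
      open import Relation.Binary.Reasoning.Setoid ≈-setoid
      P≈3 : closedFormPolynomial (+ n₂) ≈ + 3
      P≈3 = begin
        closedFormPolynomial (+ n₂)                   ≡⟨ shift (+ m) ⟩
        + 3 ℤ.+ (+ 1 ℤ.+ + 2 ℤ.* + m) ℤ.* (+ 4 ℤ.* + m ℤ.+ + 8)
                                                      ≡⟨ cong (λ y → + 3 ℤ.+ (+ 1 ℤ.+ y) ℤ.* (+ 4 ℤ.* + m ℤ.+ + 8)) (sym (ℤ.pos-* 2 m)) ⟩
        + 3 ℤ.+ Q ℤ.* (+ 4 ℤ.* + m ℤ.+ + 8)          ≈⟨ +-cong (≈-refl {+ 3}) (*-cong Q≈0 (≈-refl {+ 4 ℤ.* + m ℤ.+ + 8})) ⟩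
        + 3                                           ∎
        where
        shift : ∀ x → + 8 ℤ.* (+ 1 ℤ.+ (+ 1 ℤ.+ x)) ℤ.* (+ 1 ℤ.+ (+ 1 ℤ.+ x)) ℤ.- + 12 ℤ.* (+ 1 ℤ.+ (+ 1 ℤ.+ x)) ℤ.+ + 3
                      ≡ + 3 ℤ.+ (+ 1 ℤ.+ + 2 ℤ.* x) ℤ.* (+ 4 ℤ.* x ℤ.+ + 8)
        shift = ℤ-Solver.solve-∀
      C⁴≈1 : (+ centralBinomial m) ℤ.^ 4 ≈ + 1
      C⁴≈1 = begin
        (+ centralBinomial m) ℤ.^ 4                              ≡⟨ x^4≡[x*x]^2 (+ centralBinomial m) ⟩
        (+ centralBinomial m ℤ.* + centralBinomial m) ℤ.^ 2      ≈⟨ ^-cong ([q-1]Cj²≈1 m (ℕ.s≤s (m≤n*m m 2))) 2 ⟩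
        + 1                                                      ∎
        where
        x^4≡[x*x]^2 : ∀ x → x ℤ.* (x ℤ.* (x ℤ.* (x ℤ.* + 1))) ≡ (x ℤ.* x) ℤ.* ((x ℤ.* x) ℤ.* + 1)
        x^4≡[x*x]^2 = ℤ-Solver.solve-∀
      16*256^m*[1+m]^4≈1 : + 16 ℤ.* + (256 ^ m) ℤ.* (+ suc m) ℤ.^ 4 ≈ + 1
      16*256^m*[1+m]^4≈1 = begin
        + 16 ℤ.* + (256 ^ m) ℤ.* (+ suc m) ℤ.^ 4
          ≡⟨ cong (ℤ._* (+ suc m) ℤ.^ 4) (trans (sym (ℤ.pos-* 16 (256 ^ m)))
                                            (trans (cong +_ (16*256^m≡[2^[1+2m]]^4 m)) (pos-^ (2 ^ q) 4))) ⟩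
        (+ (2 ^ q)) ℤ.^ 4 ℤ.* (+ suc m) ℤ.^ 4         ≈⟨ *-cong (^-cong 2^q≈2 4) (≈-refl {(+ suc m) ℤ.^ 4}) ⟩
        (+ 2) ℤ.^ 4 ℤ.* (+ suc m) ℤ.^ 4               ≡⟨ sym (^-distribʳ-* (+ 2) (+ suc m) 4) ⟩
        (+ 2 ℤ.* + suc m) ℤ.^ 4                       ≡⟨ cong (ℤ._^ 4) (trans (sym (ℤ.pos-* 2 (suc m))) (cong +_ 2[1+m]≡q+1)) ⟩
        (Q ℤ.+ + 1) ℤ.^ 4                             ≈⟨ ^-cong (+-cong Q≈0 (≈-refl {+ 1})) 4 ⟩
        + 1                                           ∎

    p∤denom[n₂] : ¬ p ∣ denom n₂
    p∤denom[n₂] = p∤m*n (p∤256^k n₂) (p∤m^k (p∤q+k p∤2 ∘ subst (p ∣_) (2[1+m]+1≡q+2 m)) 4)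
      where
      2[1+m]+1≡q+2 : ∀ m → suc (2 * suc m) ≡ suc (2 * m) + 2
      2[1+m]+1≡q+2 = ℕ-Solver.solve-∀

    p∤u₂ : ¬ p ∣ u₂
    p∤u₂ = p∤m^k (p∤q+k p∤1 ∘ subst (p ∣_) 2[1+m]≡q+1) 4

    closedForm[n₂]-congruence : CongMod (closedForm n₂) ((+ (3 * p ^ (4 * r))) / 1) p (suc (4 * r))
    closedForm[n₂]-congruence = /-congMod (4 * r) (closedFormNumerator n₂) (+ (3 * p ^ (4 * r))) (denom n₂) u₂ cofactor[n₂]
      {{denom-nz n₂}} p∤denom[n₂] p∤u₂ numerator[n₂]-factorisation cofactor[n₂]≈0

    [p^r+1]/2+1≡n₂ : (p ^ r + 1) ℕ./ 2 + 1 ≡ n₂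
    [p^r+1]/2+1≡n₂ = begin
      (p ^ r + 1) ℕ./ 2 + 1     ≡⟨ cong (λ n → (n + 1) ℕ./ 2 + 1) (sym q≡p^r) ⟩
      (q + 1) ℕ./ 2 + 1         ≡⟨ cong (λ n → n ℕ./ 2 + 1) (trans (sym 2[1+m]≡q+1) (*-comm 2 (suc m))) ⟩
      (suc m * 2) ℕ./ 2 + 1     ≡⟨ cong (_+ 1) (m*n/n≡m (suc m) 2) ⟩
      suc m + 1                 ≡⟨ +-comm (suc m) 1 ⟩
      n₂                        ∎
      where open ≡-Reasoning

    sumBelow[p^r]-congruence : CongMod (sumBelow (p ^ r) term) ((+ (3 * p ^ (4 * r))) / 1) p (4 * r + 1)
    sumBelow[p^r]-congruence = subst₂ (λ s k → CongMod s ((+ (3 * p ^ (4 * r))) / 1) p k)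
      (trans (sym (sumBelow-term≡closedForm q)) (cong (λ n → sumBelow n term) q≡p^r)) (+-comm 1 (4 * r)) closedForm[q]-congruence

    sumBelow[[p^r+1]/2+1]-congruence : CongMod (sumBelow ((p ^ r + 1) ℕ./ 2 + 1) term) ((+ (3 * p ^ (4 * r))) / 1) p (4 * r + 1)
    sumBelow[[p^r+1]/2+1]-congruence = subst₂ (λ s k → CongMod s ((+ (3 * p ^ (4 * r))) / 1) p k)
      (trans (sym (sumBelow-term≡closedForm n₂)) (cong (λ n → sumBelow n term) (sym [p^r+1]/2+1≡n₂))) (+-comm 1 (4 * r)) closedForm[n₂]-congruence

open import Defs
open import Data.Nat using (ℕ; _+_; _*_; _^_; _/_; _∸_; _≤_)
open import Data.Nat.Primality using (Prime)
open import Data.Integer using (+_)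
open import Data.Rational using (ℚ) renaming (_/_ to _/ℚ_)
open import Data.Product using (_×_)
open import Relation.Nullary using (¬_)
open import Relation.Binary.PropositionalEquality using (_≡_)
open import Data.Nat using (suc; s≤s; z≤n)
open import Data.Product using (_,_)

corollary1p2 : (p r : ℕ) → Prime p → ¬ (p ≡ 2) → 1 ≤ r →
    CongMod (sumBelow (((p ^ r) + 1) / 2 + 1) term) ((+ (3 * p ^ (4 * r))) /ℚ 1) p (4 * r + 1)
    × CongMod (sumBelow (p ^ r) term) ((+ (3 * p ^ (4 * r))) /ℚ 1) p (4 * r + 1)
corollary1p2 p (suc r′) p-prime p≢2 (s≤s z≤n) =
  let m , 1+2m≡p^r = OddPrimePowers.p^r-odd p-prime p≢2 (suc r′)
      open Corollary.OddPrimePower p p-prime p≢2 m r′ 1+2m≡p^r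
  in sumBelow[[p^r+1]/2+1]-congruence , sumBelow[p^r]-congruence
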